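{- The multiple-conclusion Hilbert system $\mathsf{R}_{\mathrm{BK}}$ below is $\{p,\neg p\}$-analytic, and $\rhd_{\mathsf{R}_{\mathrm{BK}}} \;=\; \rhd_{\mathrm{BK}}$.
   Context: $L$: formulas over a countably infinite set of variables with binary $\land,\lor$ and unary $\neg$. $\mathbf A$: algebra on $\{f,u,t\}$ where each connective acts classically on $\{f,t\}$-arguments and returns $u$ if any argument is $u$. Valuations: homomorphisms into $\mathbf A$. For $\Gamma,\Delta\subseteq L$, $\Gamma\rhd_{\mathrm{BK}}\Delta$ iff there is no valuation $v$ with $v[\Gamma]\subseteq\{t\}$ and $v[\Delta]\subseteq\{f,u\}$. A Set-Set Hilbert system is a set of rule schemas $\Pi/\Sigma$ ($\Pi,\Sigma$ finite, possibly empty), with all substitution instances as rules. A derivation is a finite rooted tree with nodes labelled by sets of formulas or by $\star$: a non-leaf node labelled $\Lambda$ either has a single child labelled $\star$, provided some rule instance $\Pi/\varnothing$ has $\Pi\subseteq\Lambda$, or has children labelled $\Lambda\cup\{\psi_1\},\dots,\Lambda\cup\{\psi_m\}$ for some rule instance $\Pi/\{\psi_1,\dots,\psi_m\}$ ($m\ge1$) with $\Pi\subseteq\Lambda$. A proof of $(\Gamma,\Delta)$ is a derivation whose root is labelled by a subset of $\Gamma$ and each leaf is labelled $\star$ or by a set meeting $\Delta$; $\Gamma\rhd_{\mathsf R}\Delta$ iff such a proof exists. $\mathsf R$ is $\{p,\neg p\}$-analytic if whenever $\Gamma\rhd_{\mathsf R}\Delta$ there is a proof of $(\Gamma,\Delta)$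 whose node labels contain only formulas in $S\cup\{\neg\psi:\psi\in S\}$, $S$ being the set of subformulas of formulas in $\Gamma\cup\Delta$. $\mathsf{R}_{\mathrm{BK}}$ has rule schemas: $p,\neg p/\varnothing$; $p/\neg\neg p$; $\neg\neg p/p$; $p,q/p\land q$; $\neg p,\neg q/\neg(p\land q)$; $\neg p,q/\neg(p\land q)$; $p,\neg q/\neg(p\land q)$; $\neg(p\land q)/\neg p,p$; $\neg(p\land q)/\neg q,q$; $p\land q/p$; $p\land q/q$; $\neg p,\neg q/\neg(p\lor q)$; $\neg(p\lor q)/\neg p$; $\neg(p\lor q)/\neg q$; $p\lor q/p,\neg p$; $p\lor q/q,\neg q$; $\neg p,q/p\lor q$; $p,\neg q/p\lor q$; $p,q/p\lor q$; $p\lor q/p,q$. -}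

module Defs where

open import Level using (0ℓ)
open import Data.Nat using (ℕ)
open import Data.List using (List; []; _∷_; map)
open import Data.List.Membership.Propositional using (_∈_)
open import Data.Product using (Σ; ∃; _×_; _,_)
open import Data.Sum using (_⊎_)
open import Data.Unit using (⊤)
open import Relation.Nullary renaming (¬_ to Not)
open import Relation.Binary.PropositionalEquality using (_≡_; _≢_)

infixr 7 _∧_
infixr 6 _∨_

data Fm : Set where
  var : ℕ → Fm
  _∧_ : Fm → Fm → Fm
  _∨_ : Fm → Fm → Fm
  ¬_  : Fm → Fm

FmSet : Set₁
FmSet = Fm → Set

_⊆_ : FmSet → FmSet → Set
A ⊆ B = ∀ φ → A φ → B φ

_∪⟨_⟩ : FmSet → Fm → FmSet
(Λ ∪⟨ ψ ⟩) φ = Λ φ ⊎ φ ≡ ψ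

⟦_⟧ : List Fm → FmSet
⟦ xs ⟧ φ = φ ∈ xs

data V3 : Set where
  f u t : V3

_∧ᴬ_ : V3 → V3 → V3
u ∧ᴬ _ = u
f ∧ᴬ u = u
t ∧ᴬ u = u
f ∧ᴬ f = f
f ∧ᴬ t = f
t ∧ᴬ f = f
t ∧ᴬ t = t

_∨ᴬ_ : V3 → V3 → V3
u ∨ᴬ _ = u
f ∨ᴬ u = u
t ∨ᴬ u = u
f ∨ᴬ f = f
f ∨ᴬ t = t
t ∨ᴬ f = t
t ∨ᴬ t = t

¬ᴬ_ : V3 → V3
¬ᴬ f = t
¬ᴬ u = u
¬ᴬ t = f

record IsValuation (v : Fm → V3) : Set where
  field
    hom-∧ : ∀ φ ψ → v (φ ∧ ψ) ≡ v φ ∧ᴬ v ψ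
    hom-∨ : ∀ φ ψ → v (φ ∨ ψ) ≡ v φ ∨ᴬ v ψ
    hom-¬ : ∀ φ → v (¬ φ) ≡ ¬ᴬ v φ

_▷BK_ : FmSet → FmSet → Set
Γ ▷BK Δ = Not (Σ (Fm → V3) λ v → IsValuation v
                × (∀ φ → Γ φ → v φ ≡ t)
                × (∀ φ → Δ φ → v φ ≢ t))

_[_] : Fm → (ℕ → Fm) → Fm
var n [ σ ] = σ n
(φ ∧ ψ) [ σ ] = (φ [ σ ]) ∧ (ψ [ σ ])
(φ ∨ ψ) [ σ ] = (φ [ σ ]) ∨ (ψ [ σ ])
(¬ φ) [ σ ] = ¬ (φ [ σ ])

record Schema : Set where
  constructor _⧸_
  field
    prem : List Fm
    conc : List Fm

System : Set₁
System = Schema → Set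

Instance : System → List Fm → List Fm → Set
Instance R Π Σ′ = Σ Schema λ s → R s × Σ (ℕ → Fm) λ σ →
  Π ≡ map (_[ σ ]) (Schema.prem s) × Σ′ ≡ map (_[ σ ]) (Schema.conc s)

-- Proof R Δ 𝒜 Λ : there is a derivation with root labelled Λ, all of whose
-- leaves are ⋆ or labelled by sets meeting Δ, and all of whose node labels
-- are included in 𝒜 (take 𝒜 = everything for unrestricted proofs).
data Proof (R : System) (Δ : FmSet) (𝒜 : FmSet) : FmSet → Set₁ where
  leaf : ∀ {Λ} → Λ ⊆ 𝒜 → (Σ Fm λ φ → Λ φ × Δ φ) → Proof R Δ 𝒜 Λ
  star : ∀ {Λ} → Λ ⊆ 𝒜 → (Π : List Fm) → Instance R Π [] → ⟦ Π ⟧ ⊆ Λ →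
         Proof R Δ 𝒜 Λ
  node : ∀ {Λ} → Λ ⊆ 𝒜 → (Π : List Fm) (ψ : Fm) (ψs : List Fm) →
         Instance R Π (ψ ∷ ψs) → ⟦ Π ⟧ ⊆ Λ →
         (∀ χ → χ ∈ (ψ ∷ ψs) → Proof R Δ 𝒜 (Λ ∪⟨ χ ⟩)) →
         Proof R Δ 𝒜 Λ

Everything : FmSet
Everything _ = ⊤

ProofOf : System → FmSet → FmSet → FmSet → Set₁
ProofOf R 𝒜 Γ Δ = Σ FmSet λ Λ → Λ ⊆ Γ × Proof R Δ 𝒜 Λ

_⊢_▷_ : System → FmSet → FmSet → Set₁
R ⊢ Γ ▷ Δ = ProofOf R Everything Γ Δ

data Sub : Fm → Fm → Set where
  refl  : ∀ {φ} → Sub φ φ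
  ∧l : ∀ {φ ψ χ} → Sub φ ψ → Sub φ (ψ ∧ χ)
  ∧r : ∀ {φ ψ χ} → Sub φ χ → Sub φ (ψ ∧ χ)
  ∨l : ∀ {φ ψ χ} → Sub φ ψ → Sub φ (ψ ∨ χ)
  ∨r : ∀ {φ ψ χ} → Sub φ χ → Sub φ (ψ ∨ χ)
  ¬s : ∀ {φ ψ} → Sub φ ψ → Sub φ (¬ ψ)

SubsOf : FmSet → FmSet
SubsOf Θ φ = Σ Fm λ ψ → Θ ψ × Sub φ ψ

PNegClosure : FmSet → FmSet
PNegClosure S φ = S φ ⊎ (Σ Fm λ ψ → S ψ × φ ≡ ¬ ψ)

_⊎ˢ_ : FmSet → FmSet → FmSet
(A ⊎ˢ B) φ = A φ ⊎ B φ

IsPNegAnalytic : System → Set₁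
IsPNegAnalytic R = ∀ (Γ Δ : FmSet) → R ⊢ Γ ▷ Δ →
  ProofOf R (PNegClosure (SubsOf (Γ ⊎ˢ Δ))) Γ Δ

p q : Fm
p = var 0
q = var 1

R-BK-list : List Schema
R-BK-list =
    ((p ∷ ¬ p ∷ []) ⧸ [])
  ∷ ((p ∷ []) ⧸ (¬ ¬ p ∷ []))
  ∷ ((¬ ¬ p ∷ []) ⧸ (p ∷ []))
  ∷ ((p ∷ q ∷ []) ⧸ (p ∧ q ∷ []))
  ∷ ((¬ p ∷ ¬ q ∷ []) ⧸ (¬ (p ∧ q) ∷ []))
  ∷ ((¬ p ∷ q ∷ []) ⧸ (¬ (p ∧ q) ∷ []))
  ∷ ((p ∷ ¬ q ∷ []) ⧸ (¬ (p ∧ q) ∷ []))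
  ∷ ((¬ (p ∧ q) ∷ []) ⧸ (¬ p ∷ p ∷ []))
  ∷ ((¬ (p ∧ q) ∷ []) ⧸ (¬ q ∷ q ∷ []))
  ∷ ((p ∧ q ∷ []) ⧸ (p ∷ []))
  ∷ ((p ∧ q ∷ []) ⧸ (q ∷ []))
  ∷ ((¬ p ∷ ¬ q ∷ []) ⧸ (¬ (p ∨ q) ∷ []))
  ∷ ((¬ (p ∨ q) ∷ []) ⧸ (¬ p ∷ []))
  ∷ ((¬ (p ∨ q) ∷ []) ⧸ (¬ q ∷ []))
  ∷ ((p ∨ q ∷ []) ⧸ (p ∷ ¬ p ∷ []))
  ∷ ((p ∨ q ∷ []) ⧸ (q ∷ ¬ q ∷ []))
  ∷ ((¬ p ∷ q ∷ []) ⧸ (p ∨ q ∷ []))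
  ∷ ((p ∷ ¬ q ∷ []) ⧸ (p ∨ q ∷ []))
  ∷ ((p ∷ q ∷ []) ⧸ (p ∨ q ∷ []))
  ∷ ((p ∨ q ∷ []) ⧸ (p ∷ q ∷ []))
  ∷ []

R-BK : System
R-BK s = s ∈ R-BK-list

-- Soundness: each of the twenty schemas is valid in the three-valued matrix, which is a finite
-- truth-table check, and validity of the rules is preserved along derivations.
--
-- Completeness and analyticity: suppose (Γ, Δ) has no derivation whose branches stay inside
-- S ∪ ¬S. Using excluded middle, decide the variables one by one: make p true if adding it to
-- the premises keeps (Γ, Δ) underivable, else make ¬p true if that does, else add both p and ¬p
-- to the conclusions (the two cuts on p and ¬p show that this last step is safe). Derivations
-- are finite, so the limit pair is still underivable. For the resulting valuation ν every
-- φ ∈ S is forced to its value: for t, φ is derivable as a conclusion; for f, ¬φ is; for u,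
-- both φ and ¬φ are refutable as hypotheses. Each connective case is one or two rules of R_BK,
-- the variables were forced by construction, and underivability of the limit makes ν a
-- countermodel to Γ ▷BK Δ.

module Submission where

open import Defs
open import Level using (0ℓ)
open import Data.Product using (_×_)
open import Axiom.ExcludedMiddle using (ExcludedMiddle)

open import Function using (_∘_; id)
open import Data.Nat using (ℕ; zero; suc; _≤_; _≤′_; ≤′-refl; ≤′-step; _≤?_; _⊔_; s≤s)
open import Data.Nat.Properties using (≤⇒≤′; m≤m⊔n; m≤n⊔m)
open import Data.Fin using (Fin; #_)
open import Data.List using (List; []; _∷_; _++_; map; length; lookup)
open import Data.List.Properties using (map-∘; map-cong; map-cong-local)
open import Data.List.Relation.Unary.All as All using (All; []; _∷_; all?)
import Data.List.Relation.Unary.All.Properties as All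
open import Data.List.Relation.Unary.Any as Any using (Any; here; there; any?)
import Data.List.Relation.Unary.Any.Properties as Any
open import Data.List.Membership.Propositional using (_∈_; find)
open import Data.List.Membership.Propositional.Properties using (∈-lookup; ∈-++⁺ˡ)
open import Data.Product using (∃; _,_; proj₁; proj₂)
open import Data.Sum as Sum using (inj₁; inj₂)
open import Data.Empty using (⊥; ⊥-elim)
open import Data.Unit using (tt)
open import Relation.Nullary using (Dec; yes; no)
open import Relation.Nullary.Decidable using (from-yes; map′; _×-dec_; _→-dec_)
open import Relation.Binary.PropositionalEquality using (_≡_; _≢_; refl; sym; trans; cong; cong₂; subst₂)

eval : (ℕ → V3) → Fm → V3
eval ρ (var n) = ρ n
eval ρ (φ ∧ ψ) = eval ρ φ ∧ᴬ eval ρ ψ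
eval ρ (φ ∨ ψ) = eval ρ φ ∨ᴬ eval ρ ψ
eval ρ (¬ φ)   = ¬ᴬ eval ρ φ

eval-isValuation : ∀ ρ → IsValuation (eval ρ)
eval-isValuation ρ = record { hom-∧ = λ _ _ → refl ; hom-∨ = λ _ _ → refl ; hom-¬ = λ _ → refl }

valuation-eval : ∀ {v} → IsValuation v → ∀ φ → v φ ≡ eval (v ∘ var) φ
valuation-eval iv (var n) = refl
valuation-eval iv (φ ∧ ψ) = trans (IsValuation.hom-∧ iv φ ψ) (cong₂ _∧ᴬ_ (valuation-eval iv φ) (valuation-eval iv ψ))
valuation-eval iv (φ ∨ ψ) = trans (IsValuation.hom-∨ iv φ ψ) (cong₂ _∨ᴬ_ (valuation-eval iv φ) (valuation-eval iv ψ))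
valuation-eval iv (¬ φ)   = trans (IsValuation.hom-¬ iv φ) (cong ¬ᴬ_ (valuation-eval iv φ))

eval-subst : ∀ ρ σ φ → eval ρ (φ [ σ ]) ≡ eval (eval ρ ∘ σ) φ
eval-subst ρ σ (var n) = refl
eval-subst ρ σ (φ ∧ ψ) = cong₂ _∧ᴬ_ (eval-subst ρ σ φ) (eval-subst ρ σ ψ)
eval-subst ρ σ (φ ∨ ψ) = cong₂ _∨ᴬ_ (eval-subst ρ σ φ) (eval-subst ρ σ ψ)
eval-subst ρ σ (¬ φ)   = cong ¬ᴬ_ (eval-subst ρ σ φ)

_≟t : (a : V3) → Dec (a ≡ t)
f ≟t = no λ ()
u ≟t = no λ ()
t ≟t = yes refl

Row : List V3 → List V3 → Set
Row premises conclusions = All (_≡ t) premises → Any (_≡ t) conclusions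

row? : ∀ vs ws → Dec (Row vs ws)
row? vs ws = all? _≟t vs →-dec any? _≟t ws

Valid : Schema → Set
Valid (Π ⧸ Σ′) = ∀ ρ → Row (map (eval ρ) Π) (map (eval ρ) Σ′)

all-V3? : {P : V3 → Set} → (∀ a → Dec (P a)) → Dec (∀ a → P a)
all-V3? P? = map′ (λ { (pf , pu , pt) → λ { f → pf ; u → pu ; t → pt } })
                  (λ h → h f , h u , h t)
                  (P? f ×-dec P? u ×-dec P? t)

InPQ : Fm → Set
InPQ (var n) = n ≤ 1
InPQ (φ ∧ ψ) = InPQ φ × InPQ ψ
InPQ (φ ∨ ψ) = InPQ φ × InPQ ψ
InPQ (¬ φ)   = InPQ φ

inPQ? : ∀ φ → Dec (InPQ φ)
inPQ? (var n) = n ≤? 1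
inPQ? (φ ∧ ψ) = inPQ? φ ×-dec inPQ? ψ
inPQ? (φ ∨ ψ) = inPQ? φ ×-dec inPQ? ψ
inPQ? (¬ φ)   = inPQ? φ

assign : V3 → V3 → ℕ → V3
assign a b zero    = a
assign a b (suc _) = b

eval-assign : ∀ ρ φ → InPQ φ → eval ρ φ ≡ eval (assign (ρ 0) (ρ 1)) φ
eval-assign ρ (var zero)          _           = refl
eval-assign ρ (var (suc zero))    _           = refl
eval-assign ρ (var (suc (suc n))) (s≤s ())
eval-assign ρ (φ ∧ ψ)             (pqφ , pqψ) = cong₂ _∧ᴬ_ (eval-assign ρ φ pqφ) (eval-assign ρ ψ pqψ)
eval-assign ρ (φ ∨ ψ)             (pqφ , pqψ) = cong₂ _∨ᴬ_ (eval-assign ρ φ pqφ) (eval-assign ρ ψ pqψ)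
eval-assign ρ (¬ φ)               pqφ         = cong ¬ᴬ_ (eval-assign ρ φ pqφ)

TruthTable : Schema → Set
TruthTable (Π ⧸ Σ′) = All InPQ Π × All InPQ Σ′ ×
  (∀ a b → Row (map (eval (assign a b)) Π) (map (eval (assign a b)) Σ′))

truthTable? : ∀ s → Dec (TruthTable s)
truthTable? (Π ⧸ Σ′) = all? inPQ? Π ×-dec all? inPQ? Σ′ ×-dec
  all-V3? (λ a → all-V3? (λ b → row? _ _))

truthTable⇒valid : ∀ s → TruthTable s → Valid s
truthTable⇒valid (Π ⧸ Σ′) (pqΠ , pqΣ , table) ρ =
  subst₂ Row (sym (map-cong-local (All.map (λ {φ} → eval-assign ρ φ) pqΠ)))
             (sym (map-cong-local (All.map (λ {φ} → eval-assign ρ φ) pqΣ)))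
             (table (ρ 0) (ρ 1))

-- from-yes runs the decision procedure, checking all twenty nine-row truth tables by evaluation.
R-BK-valid : ∀ {s} → R-BK s → Valid s
R-BK-valid {s} s∈ = truthTable⇒valid s (All.lookup (from-yes (all? truthTable? R-BK-list)) s∈)

map-eval-subst : ∀ ρ σ xs → map (eval ρ) (map (_[ σ ]) xs) ≡ map (eval (eval ρ ∘ σ)) xs
map-eval-subst ρ σ xs = trans (sym (map-∘ xs)) (map-cong (eval-subst ρ σ) xs)

instance-valid : ∀ {R Π Σ′} → (∀ {s} → R s → Valid s) → Instance R Π Σ′ →
                 ∀ ρ → Row (map (eval ρ) Π) (map (eval ρ) Σ′)
instance-valid valid ((Π₀ ⧸ Σ₀) , r , σ , refl , refl) ρ =
  subst₂ Row (sym (map-eval-subst ρ σ Π₀)) (sym (map-eval-subst ρ σ Σ₀)) (valid r (eval ρ ∘ σ))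

TrueUnder : (ℕ → V3) → FmSet → Set
TrueUnder ρ Λ = ∀ φ → Λ φ → eval ρ φ ≡ t

premises-true : ∀ {Π Λ} → ⟦ Π ⟧ ⊆ Λ → ∀ ρ → TrueUnder ρ Λ → All (_≡ t) (map (eval ρ) Π)
premises-true Π⊆Λ ρ Λ-true = All.map⁺ (All.tabulate λ {φ} φ∈Π → Λ-true φ (Π⊆Λ φ φ∈Π))

module _ {R : System} (valid : ∀ {s} → R s → Valid s) where

  proof-sound : ∀ {Δ 𝒜 Λ} → Proof R Δ 𝒜 Λ → ∀ ρ → TrueUnder ρ Λ → (∀ φ → Δ φ → eval ρ φ ≢ t) → ⊥
  proof-sound (leaf _ (φ , φ∈Λ , φ∈Δ)) ρ Λ-true Δ-false = Δ-false φ φ∈Δ (Λ-true φ φ∈Λ)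
  proof-sound (star _ Π inst Π⊆Λ) ρ Λ-true Δ-false
    with () ← instance-valid valid inst ρ (premises-true Π⊆Λ ρ Λ-true)
  proof-sound (node _ Π ψ ψs inst Π⊆Λ children) ρ Λ-true Δ-false
    with χ , χ∈ , χ-true ← find (Any.map⁻ (instance-valid valid inst ρ (premises-true Π⊆Λ ρ Λ-true)))
    = proof-sound (children χ χ∈) ρ (λ { φ (inj₁ φ∈Λ) → Λ-true φ φ∈Λ ; φ (inj₂ refl) → χ-true }) Δ-false

  soundness : ∀ {𝒜 Γ Δ} → ProofOf R 𝒜 Γ Δ → Γ ▷BK Δ
  soundness (Λ , Λ⊆Γ , prf) (v , iv , Γ-true , Δ-false) =
    proof-sound prf (v ∘ var)
      (λ φ φ∈Λ → trans (sym (valuation-eval iv φ)) (Γ-true φ (Λ⊆Γ φ φ∈Λ)))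
      (λ φ φ∈Δ → Δ-false φ φ∈Δ ∘ trans (valuation-eval iv φ))

relax : ∀ {R Δ 𝒜 𝒜′ Λ} → 𝒜 ⊆ 𝒜′ → Proof R Δ 𝒜 Λ → Proof R Δ 𝒜′ Λ
relax 𝒜⊆𝒜′ (leaf Λ⊆𝒜 hit) = leaf (λ φ → 𝒜⊆𝒜′ φ ∘ Λ⊆𝒜 φ) hit
relax 𝒜⊆𝒜′ (star Λ⊆𝒜 Π inst Π⊆Λ) = star (λ φ → 𝒜⊆𝒜′ φ ∘ Λ⊆𝒜 φ) Π inst Π⊆Λ
relax 𝒜⊆𝒜′ (node Λ⊆𝒜 Π ψ ψs inst Π⊆Λ children) =
  node (λ φ → 𝒜⊆𝒜′ φ ∘ Λ⊆𝒜 φ) Π ψ ψs inst Π⊆Λ (λ χ χ∈ → relax 𝒜⊆𝒜′ (children χ χ∈))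

Sub-trans : ∀ {φ ψ χ} → Sub φ ψ → Sub ψ χ → Sub φ χ
Sub-trans φ≤ψ refl    = φ≤ψ
Sub-trans φ≤ψ (∧l ψ≤) = ∧l (Sub-trans φ≤ψ ψ≤)
Sub-trans φ≤ψ (∧r ψ≤) = ∧r (Sub-trans φ≤ψ ψ≤)
Sub-trans φ≤ψ (∨l ψ≤) = ∨l (Sub-trans φ≤ψ ψ≤)
Sub-trans φ≤ψ (∨r ψ≤) = ∨r (Sub-trans φ≤ψ ψ≤)
Sub-trans φ≤ψ (¬s ψ≤) = ¬s (Sub-trans φ≤ψ ψ≤)

SubsOf-sub : ∀ {Θ φ ψ} → Sub φ ψ → SubsOf Θ ψ → SubsOf Θ φ
SubsOf-sub φ≤ψ (θ , θ∈Θ , ψ≤θ) = θ , θ∈Θ , Sub-trans φ≤ψ ψ≤θ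

⋃ : (ℕ → FmSet) → FmSet
⋃ P φ = ∃ λ n → P n φ

Increasing : (ℕ → FmSet) → Set
Increasing P = ∀ n → P n ⊆ P (suc n)

increasing-mono : ∀ {P} → Increasing P → ∀ {m n} → m ≤ n → P m ⊆ P n
increasing-mono {P} P↑ = go ∘ ≤⇒≤′
  where
  go : ∀ {m n} → m ≤′ n → P m ⊆ P n
  go ≤′-refl       = λ _ → id
  go (≤′-step m≤n) = λ φ → P↑ _ φ ∘ go m≤n φ

uniform-bound : ∀ {A : Set} {P : ℕ → A → Set} → (∀ {m n x} → m ≤ n → P m x → P n x) →
                ∀ xs → (∀ x → x ∈ xs → ∃ λ n → P n x) → ∃ λ N → ∀ x → x ∈ xs → P N x
uniform-bound mono []       bounded = 0 , λ _ ()
uniform-bound mono (x ∷ xs) bounded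
  with n , px ← bounded x (here refl)
     | N , pxs ← uniform-bound mono xs (λ y → bounded y ∘ there)
  = n ⊔ N , λ { _ (here refl) → mono (m≤m⊔n n N) px ; y (there y∈) → mono (m≤n⊔m n N) (pxs y y∈) }

-- Deriv X Y L: a derivation whose root is labelled by X together with the local hypotheses L,
-- whose leaves meet Y, and whose branches only introduce formulas of 𝒜. Keeping the finitely
-- many local hypotheses apart from the base X is what makes derivations compact in X.
module Derivations (R : System) (𝒜 : FmSet) where

  data Deriv (X Y : FmSet) : List Fm → Set where
    leaf : ∀ {L} φ → (X ⊎ˢ ⟦ L ⟧) φ → Y φ → Deriv X Y L
    star : ∀ {L} Π → Instance R Π [] → ⟦ Π ⟧ ⊆ (X ⊎ˢ ⟦ L ⟧) → Deriv X Y L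
    node : ∀ {L} Π ψ ψs → Instance R Π (ψ ∷ ψs) → ⟦ Π ⟧ ⊆ (X ⊎ˢ ⟦ L ⟧) →
           (∀ χ → χ ∈ ψ ∷ ψs → 𝒜 χ × Deriv X Y (χ ∷ L)) → Deriv X Y L

  ⊆-∷ : ∀ {X X′ L L′} χ → (X ⊎ˢ ⟦ L ⟧) ⊆ (X′ ⊎ˢ ⟦ L′ ⟧) → (X ⊎ˢ ⟦ χ ∷ L ⟧) ⊆ (X′ ⊎ˢ ⟦ χ ∷ L′ ⟧)
  ⊆-∷ χ L⊆L′ φ (inj₁ x)            = Sum.map₂ there (L⊆L′ φ (inj₁ x))
  ⊆-∷ χ L⊆L′ φ (inj₂ (here φ≡χ))   = inj₂ (here φ≡χ)
  ⊆-∷ χ L⊆L′ φ (inj₂ (there φ∈L))  = Sum.map₂ there (L⊆L′ φ (inj₂ φ∈L))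

  weaken : ∀ {X Y L X′ Y′ L′} → Deriv X Y L → (X ⊎ˢ ⟦ L ⟧) ⊆ (X′ ⊎ˢ ⟦ L′ ⟧) → Y ⊆ Y′ → Deriv X′ Y′ L′
  weaken (leaf φ φ∈ φ∈Y) L⊆L′ Y⊆Y′ = leaf φ (L⊆L′ φ φ∈) (Y⊆Y′ φ φ∈Y)
  weaken (star Π inst Π⊆) L⊆L′ Y⊆Y′ = star Π inst (λ φ → L⊆L′ φ ∘ Π⊆ φ)
  weaken (node Π ψ ψs inst Π⊆ children) L⊆L′ Y⊆Y′ =
    node Π ψ ψs inst (λ φ → L⊆L′ φ ∘ Π⊆ φ) λ χ χ∈ →
      let χ∈𝒜 , d = children χ χ∈ in χ∈𝒜 , weaken d (⊆-∷ χ L⊆L′) Y⊆Y′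

  Consistent : FmSet × FmSet → Set
  Consistent (X , Y) = Deriv X Y [] → ⊥

  []⊆ : ∀ {X L} → (X ⊎ˢ ⟦ [] ⟧) ⊆ (X ⊎ˢ ⟦ L ⟧)
  []⊆ φ = Sum.map₂ λ ()

  discharge : ∀ {X L φ} → (X ⊎ˢ ⟦ L ⟧) φ → (X ⊎ˢ ⟦ φ ∷ L ⟧) ⊆ (X ⊎ˢ ⟦ L ⟧)
  discharge φ∈ _ (inj₁ x)              = inj₁ x
  discharge φ∈ _ (inj₂ (here refl))    = φ∈
  discharge φ∈ _ (inj₂ (there ψ∈L))    = inj₂ ψ∈L

  cut : ∀ {X Y L} φ → Deriv X (Y ∪⟨ φ ⟩) L → Deriv X Y (φ ∷ L) → Deriv X Y L
  cut φ (leaf ψ ψ∈ (inj₁ ψ∈Y)) dφ    = leaf ψ ψ∈ ψ∈Y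
  cut φ (leaf ψ ψ∈ (inj₂ refl)) dφ   = weaken dφ (discharge ψ∈) (λ _ → id)
  cut φ (star Π inst Π⊆) dφ          = star Π inst Π⊆
  cut φ (node Π ψ ψs inst Π⊆ children) dφ =
    node Π ψ ψs inst Π⊆ λ χ χ∈ →
      let χ∈𝒜 , d = children χ χ∈ in
      χ∈𝒜 , cut φ d (weaken dφ (⊆-∷ φ (λ _ → Sum.map₂ there)) (λ _ → id))

  cut-all : ∀ {X Y} Π L → All (λ π → Deriv X (Y ∪⟨ π ⟩) []) Π → Deriv X Y (Π ++ L) → Deriv X Y L
  cut-all []      L []         d = d
  cut-all (π ∷ Π) L (dπ ∷ dΠ) d = cut-all Π L dΠ (cut π (weaken dπ []⊆ (λ _ → id)) d)

  toProof : ∀ {X Y L Λ} → Deriv X Y L → (X ⊎ˢ ⟦ L ⟧) ⊆ Λ → Λ ⊆ 𝒜 → Proof R Y 𝒜 Λ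
  toProof (leaf φ φ∈ φ∈Y) L⊆Λ Λ⊆𝒜 = leaf Λ⊆𝒜 (φ , L⊆Λ φ φ∈ , φ∈Y)
  toProof (star Π inst Π⊆) L⊆Λ Λ⊆𝒜 = star Λ⊆𝒜 Π inst (λ φ → L⊆Λ φ ∘ Π⊆ φ)
  toProof {X} {Y} {L} {Λ} (node Π ψ ψs inst Π⊆ children) L⊆Λ Λ⊆𝒜 =
    node Λ⊆𝒜 Π ψ ψs inst (λ φ → L⊆Λ φ ∘ Π⊆ φ) λ χ χ∈ →
      let χ∈𝒜 , d = children χ χ∈ in
      toProof d (labels-∷ χ) λ { φ (inj₁ φ∈Λ) → Λ⊆𝒜 φ φ∈Λ ; φ (inj₂ refl) → χ∈𝒜 }
    where
    labels-∷ : ∀ χ → (X ⊎ˢ ⟦ χ ∷ L ⟧) ⊆ (Λ ∪⟨ χ ⟩)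
    labels-∷ χ φ (inj₁ x)            = inj₁ (L⊆Λ φ (inj₁ x))
    labels-∷ χ φ (inj₂ (here φ≡χ))   = inj₂ φ≡χ
    labels-∷ χ φ (inj₂ (there φ∈L))  = inj₁ (L⊆Λ φ (inj₂ φ∈L))

  module Compactness {T F : ℕ → FmSet} (T↑ : Increasing T) (F↑ : Increasing F) where

    labels-mono : ∀ {L m n φ} → m ≤ n → (T m ⊎ˢ ⟦ L ⟧) φ → (T n ⊎ˢ ⟦ L ⟧) φ
    labels-mono m≤n = Sum.map₁ (increasing-mono T↑ m≤n _)

    deriv-mono : ∀ {L m n} → m ≤ n → Deriv (T m) (F m) L → Deriv (T n) (F n) L
    deriv-mono m≤n d = weaken d (λ _ → labels-mono m≤n) (increasing-mono F↑ m≤n)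

    labels-bound : ∀ {L φ} → (⋃ T ⊎ˢ ⟦ L ⟧) φ → ∃ λ n → (T n ⊎ˢ ⟦ L ⟧) φ
    labels-bound (inj₁ (n , x)) = n , inj₁ x
    labels-bound (inj₂ φ∈L)     = 0 , inj₂ φ∈L

    premises-bound : ∀ {L} Π → ⟦ Π ⟧ ⊆ (⋃ T ⊎ˢ ⟦ L ⟧) → ∃ λ N → ⟦ Π ⟧ ⊆ (T N ⊎ˢ ⟦ L ⟧)
    premises-bound Π Π⊆ = uniform-bound labels-mono Π (λ φ → labels-bound ∘ Π⊆ φ)

    compact : ∀ {L} → Deriv (⋃ T) (⋃ F) L → ∃ λ N → Deriv (T N) (F N) L
    compact (leaf φ φ∈ (k , φ∈F))
      with n , φ∈′ ← labels-bound φ∈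
      = n ⊔ k , leaf φ (labels-mono (m≤m⊔n n k) φ∈′) (increasing-mono F↑ (m≤n⊔m n k) φ φ∈F)
    compact (star Π inst Π⊆)
      with N , Π⊆′ ← premises-bound Π Π⊆
      = N , star Π inst Π⊆′
    compact {L} (node Π ψ ψs inst Π⊆ children)
      with N₁ , Π⊆′ ← premises-bound Π Π⊆
         | N₂ , children′ ← uniform-bound {P = λ n χ → 𝒜 χ × Deriv (T n) (F n) (χ ∷ L)}
                              (λ m≤n (χ∈𝒜 , d) → χ∈𝒜 , deriv-mono m≤n d) (ψ ∷ ψs)
                              (λ χ χ∈ → let χ∈𝒜 , d = children χ χ∈ ; N , d′ = compact d in N , χ∈𝒜 , d′)
      = N₁ ⊔ N₂ , node Π ψ ψs inst (λ φ → labels-mono (m≤m⊔n N₁ N₂) ∘ Π⊆′ φ)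
                    λ χ χ∈ → let χ∈𝒜 , d = children′ χ χ∈ in χ∈𝒜 , deriv-mono (m≤n⊔m N₁ N₂) d

⟨_,_⟩ : Fm → Fm → ℕ → Fm
⟨ α , β ⟩ zero          = α
⟨ α , β ⟩ (suc zero)    = β
⟨ α , β ⟩ (suc (suc n)) = var (suc (suc n))

R-BK-rule : (i : Fin (length R-BK-list)) (α β : Fm) →
            Instance R-BK (map (_[ ⟨ α , β ⟩ ]) (Schema.prem (lookup R-BK-list i)))
                          (map (_[ ⟨ α , β ⟩ ]) (Schema.conc (lookup R-BK-list i)))
R-BK-rule i α β = lookup R-BK-list i , ∈-lookup i , ⟨ α , β ⟩ , refl , refl

module Analytic (Θ : FmSet) where

  S 𝒜 : FmSet
  S = SubsOf Θ
  𝒜 = PNegClosure S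

  open Derivations R-BK 𝒜 public

  S⊆𝒜 : ∀ {φ} → S φ → 𝒜 φ
  S⊆𝒜 = inj₁

  ¬S⊆𝒜 : ∀ {φ} → S φ → 𝒜 (¬ φ)
  ¬S⊆𝒜 {φ} φ∈S = inj₂ (φ , φ∈S , refl)

  Records : ℕ → V3 → FmSet → FmSet → Set
  Records n t X Y = X (var n)
  Records n f X Y = X (¬ var n)
  Records n u X Y = Y (var n) × Y (¬ var n)

  module Forcing (T F : FmSet) where

    Affirmed Refuted : Fm → Set
    Affirmed φ = Deriv T (F ∪⟨ φ ⟩) []
    Refuted φ  = Deriv T F (φ ∷ [])

    Forced : Fm → V3 → Set
    Forced φ t = Affirmed φ
    Forced φ f = Affirmed (¬ φ)
    Forced φ u = Refuted φ × Refuted (¬ φ)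

    affirm : ∀ {Π ψ} → Instance R-BK Π (ψ ∷ []) → 𝒜 ψ → All Affirmed Π → Affirmed ψ
    affirm {Π} {ψ} inst ψ∈𝒜 affirmed =
      cut-all Π [] (All.map (λ d → weaken d (λ _ → id) (λ _ → Sum.map₁ inj₁)) affirmed)
        (node Π ψ [] inst (λ _ → inj₂ ∘ ∈-++⁺ˡ)
          λ { _ (here refl) → ψ∈𝒜 , leaf ψ (inj₂ (here refl)) (inj₂ refl) })

    refute : ∀ {ψ χ χs} → Instance R-BK (ψ ∷ []) (χ ∷ χs) →
             All (λ χ → 𝒜 χ × Refuted χ) (χ ∷ χs) → Refuted ψ
    refute {ψ} {χ} {χs} inst refuted =
      node (ψ ∷ []) χ χs inst (λ { _ (here refl) → inj₂ (here refl) }) λ χ′ χ′∈ →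
        let χ′∈𝒜 , d = All.lookup refuted χ′∈ in χ′∈𝒜 , weaken d (⊆-∷ χ′ []⊆) (λ _ → id)

    forced-¬ : ∀ {α a} → S (¬ α) → Forced α a → Forced (¬ α) (¬ᴬ a)
    forced-¬ {α} {t} ¬α∈S h          = affirm (R-BK-rule (# 1) α α) (¬S⊆𝒜 ¬α∈S) (h ∷ [])
    forced-¬ {α} {f} ¬α∈S h          = h
    forced-¬ {α} {u} ¬α∈S (rα , r¬α) =
      r¬α , refute (R-BK-rule (# 2) α α) ((S⊆𝒜 (SubsOf-sub (¬s refl) ¬α∈S) , rα) ∷ [])

    undetermined-∧ˡ : ∀ {α β} → S α → Forced α u → Forced (α ∧ β) u
    undetermined-∧ˡ α∈S (rα , r¬α) =
      refute (R-BK-rule (# 9) _ _) ((S⊆𝒜 α∈S , rα) ∷ []) ,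
      refute (R-BK-rule (# 7) _ _) ((¬S⊆𝒜 α∈S , r¬α) ∷ (S⊆𝒜 α∈S , rα) ∷ [])

    undetermined-∧ʳ : ∀ {α β} → S β → Forced β u → Forced (α ∧ β) u
    undetermined-∧ʳ β∈S (rβ , r¬β) =
      refute (R-BK-rule (# 10) _ _) ((S⊆𝒜 β∈S , rβ) ∷ []) ,
      refute (R-BK-rule (# 8) _ _) ((¬S⊆𝒜 β∈S , r¬β) ∷ (S⊆𝒜 β∈S , rβ) ∷ [])

    forced-∧ : ∀ {α β a b} → S (α ∧ β) → Forced α a → Forced β b → Forced (α ∧ β) (a ∧ᴬ b)
    forced-∧ {a = t} {t} ∧∈S hα hβ = affirm (R-BK-rule (# 3) _ _) (S⊆𝒜 ∧∈S) (hα ∷ hβ ∷ [])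
    forced-∧ {a = f} {f} ∧∈S hα hβ = affirm (R-BK-rule (# 4) _ _) (¬S⊆𝒜 ∧∈S) (hα ∷ hβ ∷ [])
    forced-∧ {a = f} {t} ∧∈S hα hβ = affirm (R-BK-rule (# 5) _ _) (¬S⊆𝒜 ∧∈S) (hα ∷ hβ ∷ [])
    forced-∧ {a = t} {f} ∧∈S hα hβ = affirm (R-BK-rule (# 6) _ _) (¬S⊆𝒜 ∧∈S) (hα ∷ hβ ∷ [])
    forced-∧ {a = u}     ∧∈S hα _  = undetermined-∧ˡ (SubsOf-sub (∧l refl) ∧∈S) hα
    forced-∧ {a = f} {u} ∧∈S _  hβ = undetermined-∧ʳ (SubsOf-sub (∧r refl) ∧∈S) hβ
    forced-∧ {a = t} {u} ∧∈S _  hβ = undetermined-∧ʳ (SubsOf-sub (∧r refl) ∧∈S) hβ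

    undetermined-∨ˡ : ∀ {α β} → S α → Forced α u → Forced (α ∨ β) u
    undetermined-∨ˡ α∈S (rα , r¬α) =
      refute (R-BK-rule (# 14) _ _) ((S⊆𝒜 α∈S , rα) ∷ (¬S⊆𝒜 α∈S , r¬α) ∷ []) ,
      refute (R-BK-rule (# 12) _ _) ((¬S⊆𝒜 α∈S , r¬α) ∷ [])

    undetermined-∨ʳ : ∀ {α β} → S β → Forced β u → Forced (α ∨ β) u
    undetermined-∨ʳ β∈S (rβ , r¬β) =
      refute (R-BK-rule (# 15) _ _) ((S⊆𝒜 β∈S , rβ) ∷ (¬S⊆𝒜 β∈S , r¬β) ∷ []) ,
      refute (R-BK-rule (# 13) _ _) ((¬S⊆𝒜 β∈S , r¬β) ∷ [])

    forced-∨ : ∀ {α β a b} → S (α ∨ β) → Forced α a → Forced β b → Forced (α ∨ β) (a ∨ᴬ b)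
    forced-∨ {a = t} {t} ∨∈S hα hβ = affirm (R-BK-rule (# 18) _ _) (S⊆𝒜 ∨∈S) (hα ∷ hβ ∷ [])
    forced-∨ {a = f} {t} ∨∈S hα hβ = affirm (R-BK-rule (# 16) _ _) (S⊆𝒜 ∨∈S) (hα ∷ hβ ∷ [])
    forced-∨ {a = t} {f} ∨∈S hα hβ = affirm (R-BK-rule (# 17) _ _) (S⊆𝒜 ∨∈S) (hα ∷ hβ ∷ [])
    forced-∨ {a = f} {f} ∨∈S hα hβ = affirm (R-BK-rule (# 11) _ _) (¬S⊆𝒜 ∨∈S) (hα ∷ hβ ∷ [])
    forced-∨ {a = u}     ∨∈S hα _  = undetermined-∨ˡ (SubsOf-sub (∨l refl) ∨∈S) hα
    forced-∨ {a = f} {u} ∨∈S _  hβ = undetermined-∨ʳ (SubsOf-sub (∨r refl) ∨∈S) hβ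
    forced-∨ {a = t} {u} ∨∈S _  hβ = undetermined-∨ʳ (SubsOf-sub (∨r refl) ∨∈S) hβ

    forced-var : ∀ {X Y n c} → X ⊆ T → Y ⊆ F → Records n c X Y → Forced (var n) c
    forced-var {n = n} {t} X⊆T Y⊆F x         = leaf (var n) (inj₁ (X⊆T _ x)) (inj₂ refl)
    forced-var {n = n} {f} X⊆T Y⊆F x         = leaf (¬ var n) (inj₁ (X⊆T _ x)) (inj₂ refl)
    forced-var {n = n} {u} X⊆T Y⊆F (y , ¬y) =
      leaf (var n) (inj₂ (here refl)) (Y⊆F _ y) , leaf (¬ var n) (inj₂ (here refl)) (Y⊆F _ ¬y)

    module _ (consistent : Consistent (T , F)) where

      forced-premise : ∀ {γ c} → T γ → Forced γ c → c ≡ t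
      forced-premise {c = t} γ∈T _         = refl
      forced-premise {γ} {f} γ∈T a¬γ       = ⊥-elim (consistent (cut (¬ γ) a¬γ explosion))
        where
        explosion : Deriv T F (¬ γ ∷ [])
        explosion = star (γ ∷ ¬ γ ∷ []) (R-BK-rule (# 0) γ γ)
          λ { _ (here refl) → inj₁ γ∈T ; _ (there (here refl)) → inj₂ (here refl) }
      forced-premise {c = u} γ∈T (rγ , _)  = ⊥-elim (consistent (weaken rγ (discharge (inj₁ γ∈T)) (λ _ → id)))

      forced-conclusion : ∀ {δ c} → F δ → Forced δ c → c ≢ t
      forced-conclusion {c = t} δ∈F aδ _ =
        consistent (weaken aδ (λ _ → id) λ { _ (inj₁ y) → y ; _ (inj₂ refl) → δ∈F })

module Lindenbaum (lem : ExcludedMiddle 0ℓ) (Γ Δ : FmSet) where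

  open Analytic (Γ ⊎ˢ Δ)

  choose : ∀ {A B : Set} → Dec A → Dec B → V3
  choose (no _)  _       = t
  choose (yes _) (no _)  = f
  choose (yes _) (yes _) = u

  value : ℕ → FmSet × FmSet → V3
  value n (X , Y) = choose (lem {Deriv X Y (var n ∷ [])}) (lem {Deriv X Y (¬ var n ∷ [])})

  extend : ℕ → V3 → FmSet × FmSet → FmSet × FmSet
  extend n t (X , Y) = X ∪⟨ var n ⟩ , Y
  extend n f (X , Y) = X ∪⟨ ¬ var n ⟩ , Y
  extend n u (X , Y) = X , Y ∪⟨ var n ⟩ ∪⟨ ¬ var n ⟩

  stage : ℕ → FmSet × FmSet
  stage zero    = Γ , Δ
  stage (suc n) = extend n (value n (stage n)) (stage n)

  T F : ℕ → FmSet
  T = proj₁ ∘ stage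
  F = proj₂ ∘ stage

  ν : ℕ → V3
  ν n = value n (stage n)

  extend-⊆ : ∀ n c XY → proj₁ XY ⊆ proj₁ (extend n c XY) × proj₂ XY ⊆ proj₂ (extend n c XY)
  extend-⊆ n t _ = (λ _ → inj₁) , (λ _ → id)
  extend-⊆ n f _ = (λ _ → inj₁) , (λ _ → id)
  extend-⊆ n u _ = (λ _ → id) , (λ _ → inj₁ ∘ inj₁)

  extend-records : ∀ n c XY → Records n c (proj₁ (extend n c XY)) (proj₂ (extend n c XY))
  extend-records n t _ = inj₂ refl
  extend-records n f _ = inj₂ refl
  extend-records n u _ = inj₁ (inj₂ refl) , inj₂ refl

  base-to-local : ∀ {X φ} → ((X ∪⟨ φ ⟩) ⊎ˢ ⟦ [] ⟧) ⊆ (X ⊎ˢ ⟦ φ ∷ [] ⟧)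
  base-to-local _ (inj₁ (inj₁ x))    = inj₁ x
  base-to-local _ (inj₁ (inj₂ refl)) = inj₂ (here refl)

  extend-consistent : ∀ n {X Y} (d : Dec (Deriv X Y (var n ∷ []))) (d¬ : Dec (Deriv X Y (¬ var n ∷ []))) →
                      Consistent (X , Y) → Consistent (extend n (choose d d¬) (X , Y))
  extend-consistent n (no ¬d)  _         _          = ¬d ∘ λ d → weaken d base-to-local (λ _ → id)
  extend-consistent n (yes _)  (no ¬d¬)  _          = ¬d¬ ∘ λ d → weaken d base-to-local (λ _ → id)
  extend-consistent n (yes d) (yes d¬) consistent =
    consistent ∘ λ d′ → cut (var n) (cut (¬ var n) d′ (weaken d¬ (λ _ → id) (λ _ → inj₁))) d

  stage-consistent : Consistent (Γ , Δ) → ∀ n → Consistent (stage n)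
  stage-consistent consistent zero    = consistent
  stage-consistent consistent (suc n) = extend-consistent n lem lem (stage-consistent consistent n)

  open Compactness {T} {F} (λ n → proj₁ (extend-⊆ n (ν n) (stage n))) (λ n → proj₂ (extend-⊆ n (ν n) (stage n)))
  open Forcing (⋃ T) (⋃ F)

  limit-consistent : Consistent (Γ , Δ) → Consistent (⋃ T , ⋃ F)
  limit-consistent consistent d = let N , d′ = compact d in stage-consistent consistent N d′

  truth : ∀ φ → S φ → Forced φ (eval ν φ)
  truth (var n) _     = forced-var (λ _ → suc n ,_) (λ _ → suc n ,_) (extend-records n (ν n) (stage n))
  truth (¬ α)   ¬α∈S  = forced-¬ ¬α∈S (truth α (SubsOf-sub (¬s refl) ¬α∈S))
  truth (α ∧ β) ∧∈S   = forced-∧ ∧∈S (truth α (SubsOf-sub (∧l refl) ∧∈S)) (truth β (SubsOf-sub (∧r refl) ∧∈S))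
  truth (α ∨ β) ∨∈S   = forced-∨ ∨∈S (truth α (SubsOf-sub (∨l refl) ∨∈S)) (truth β (SubsOf-sub (∨r refl) ∨∈S))

  complete : Γ ▷BK Δ → Deriv Γ Δ []
  complete bk with lem {Deriv Γ Δ []}
  ... | yes d          = d
  ... | no consistent  = ⊥-elim (bk (eval ν , eval-isValuation ν , Γ-true , Δ-false))
    where
    Γ-true : ∀ γ → Γ γ → eval ν γ ≡ t
    Γ-true γ γ∈Γ = forced-premise (limit-consistent consistent) (0 , γ∈Γ) (truth γ (γ , inj₁ γ∈Γ , refl))
    Δ-false : ∀ δ → Δ δ → eval ν δ ≢ t
    Δ-false δ δ∈Δ = forced-conclusion (limit-consistent consistent) (0 , δ∈Δ) (truth δ (δ , inj₂ δ∈Δ , refl))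

  analytic-proof : Deriv Γ Δ [] → ProofOf R-BK 𝒜 Γ Δ
  analytic-proof d = Γ , (λ _ → id) ,
    toProof d (λ { _ (inj₁ γ∈Γ) → γ∈Γ ; _ (inj₂ ()) }) (λ γ γ∈Γ → S⊆𝒜 (γ , inj₁ γ∈Γ , refl))

analytic-completeness : ExcludedMiddle 0ℓ → ∀ Γ Δ → Γ ▷BK Δ → ProofOf R-BK (PNegClosure (SubsOf (Γ ⊎ˢ Δ))) Γ Δ
analytic-completeness lem Γ Δ = analytic-proof ∘ complete
  where open Lindenbaum lem Γ Δ

theorem7 : ExcludedMiddle 0ℓ →
    IsPNegAnalytic R-BK
    × (∀ (Γ Δ : FmSet) → (R-BK ⊢ Γ ▷ Δ → Γ ▷BK Δ) × (Γ ▷BK Δ → R-BK ⊢ Γ ▷ Δ))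
theorem7 lem =
  (λ Γ Δ → analytic-completeness lem Γ Δ ∘ soundness R-BK-valid) ,
  (λ Γ Δ → soundness R-BK-valid , unrestrict ∘ analytic-completeness lem Γ Δ)
  where
  unrestrict : ∀ {𝒜 Γ Δ} → ProofOf R-BK 𝒜 Γ Δ → R-BK ⊢ Γ ▷ Δ
  unrestrict (Λ , Λ⊆Γ , prf) = Λ , Λ⊆Γ , relax (λ _ _ → tt) prf
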